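{- Run the contraction procedure described in the context on a 4-regular, 4-edge-connected multigraph $G_0$ containing vertices $r_0,u_0,v_0$ such that there are two parallel edges between $r_0$ and $u_0$ and two parallel edges between $r_0$ and $v_0$. Then the graph $G$ remaining when the procedure terminates is a double cycle.
   Context: For a multigraph $G=(V,E)$ and $S\subseteq V$, $\partial S$ is the set of edges with exactly one endpoint in $S$. $S$ is proper if $1<|S|<|V|-1$; $S$ is tight if $|\partial S|$ equals the minimum edge-cut size of $G$ (here 4). Two sets $S,S'$ cross if $S\cap S'$, $S\setminus S'$, $S'\setminus S$ and $V\setminus(S\cup S')$ are all nonempty. $G/X$ denotes the multigraph obtained by contracting $X$ to a single vertex and deleting self-loops. A double cycle is a cycle in which every edge is replaced by two parallel edges (including the graph on two vertices joined by four parallel edges). Contraction procedure: set $G:=G_0$. While $G$ has a proper tight set not crossed by any proper tight set: let $S$ be an inclusion-minimal set among the proper tight sets of $G$ not containing $r_0$ that are not crossed by any proper tight set; let $G':=G/(V(G)\setminus S)$; then replace $G$ by $G/S$. -}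

module Defs where

open import Data.Nat using (ℕ; zero; suc; _+_; _∸_; _≤_; _<_)
open import Data.Bool using (Bool; true; false; if_then_else_; _∧_; not)
open import Data.Fin using (Fin; toℕ; _≟_)
open import Data.Fin.Subset using (Subset; _∈_; _∉_; _⊆_; _∩_; _─_; _∪_; ∁; ∣_∣; Nonempty)
open import Data.Vec using (lookup)
open import Data.Product using (Σ; ∃; _×_; _,_)
open import Data.Sum using (_⊎_)
open import Relation.Nullary using (¬_; does)
open import Relation.Binary.PropositionalEquality using (_≡_; _≢_)
open import Relation.Binary.Construct.Closure.ReflexiveTransitive using (Star)
open import Function.Definitions using (Injective; Surjective)

∑ : ∀ {n} → (Fin n → ℕ) → ℕ
∑ {zero}  f = 0
∑ {suc n} f = f Fin.zero + ∑ (λ i → f (Fin.suc i))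

record MG (n : ℕ) : Set where
  field
    mult     : Fin n → Fin n → ℕ
    mult-sym : ∀ u v → mult u v ≡ mult v u
    loopless : ∀ v → mult v v ≡ 0
open MG public

cut : ∀ {n} → MG n → Subset n → ℕ
cut G S = ∑ λ u → ∑ λ v →
  if lookup S u ∧ not (lookup S v) then mult G u v else 0

deg : ∀ {n} → MG n → Fin n → ℕ
deg G v = ∑ λ w → mult G v w

FourRegular : ∀ {n} → MG n → Set
FourRegular G = ∀ v → deg G v ≡ 4

IsCutSet : ∀ {n} → Subset n → Set
IsCutSet {n} T = 0 < ∣ T ∣ × ∣ T ∣ < n

EdgeConnected : ∀ {n} → ℕ → MG n → Set
EdgeConnected k G = ∀ T → IsCutSet T → k ≤ cut G T

Proper : ∀ {n} → Subset n → Set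
Proper {n} S = 1 < ∣ S ∣ × suc ∣ S ∣ < n

Tight : ∀ {n} → MG n → Subset n → Set
Tight G S = IsCutSet S × (∀ T → IsCutSet T → cut G S ≤ cut G T)

ProperTight : ∀ {n} → MG n → Subset n → Set
ProperTight G S = Proper S × Tight G S

Cross : ∀ {n} → Subset n → Subset n → Set
Cross S S' = Nonempty (S ∩ S') × Nonempty (S ─ S') × Nonempty (S' ─ S)
           × Nonempty (∁ (S ∪ S'))

Uncrossed : ∀ {n} → MG n → Subset n → Set
Uncrossed G S = ProperTight G S × (∀ T → ProperTight G T → ¬ Cross T S)

Candidate : ∀ {n} → MG n → Fin n → Subset n → Set
Candidate G r S = Uncrossed G S × r ∉ S

MinCandidate : ∀ {n} → MG n → Fin n → Subset n → Set
MinCandidate G r S = Candidate G r S × (∀ T → Candidate G r T → T ⊆ S → T ≡ S)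

-- H is (isomorphic to) G/X via the quotient map φ : V(G) → V(H):
-- φ is surjective, identifies exactly the vertices of X, and the
-- multiplicity between distinct vertices a,b of H is the number of
-- edges of G between φ⁻¹(a) and φ⁻¹(b) (self-loops deleted since H is loopless).
IsContraction : ∀ {n m} → MG n → Subset n → MG m → (Fin n → Fin m) → Set
IsContraction G X H φ =
  Surjective _≡_ _≡_ φ
  × (∀ x y → (φ x ≡ φ y → x ≡ y ⊎ (x ∈ X × y ∈ X))
           × (x ≡ y ⊎ (x ∈ X × y ∈ X) → φ x ≡ φ y))
  × (∀ a b → a ≢ b → mult H a b ≡
        ∑ λ x → ∑ λ y →
          if does (φ x ≟ a) ∧ does (φ y ≟ b) then mult G x y else 0)

-- state of the procedure: current graph with the tracked vertex r₀
State : Set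
State = Σ ℕ λ n → MG n × Fin n

data Step : State → State → Set where
  step : ∀ {n m} (G : MG n) (r : Fin n) (S : Subset n) (H : MG m)
           (φ : Fin n → Fin m) →
         MinCandidate G r S → IsContraction G S H φ →
         Step (n , G , r) (m , H , φ r)

Terminal : ∀ {n} → MG n → Set
Terminal G = ¬ (∃ λ S → Uncrossed G S)

CycSucc : ∀ {m} → Fin m → Fin m → Set
CycSucc {m} i j = toℕ j ≡ suc (toℕ i) ⊎ (suc (toℕ i) ≡ m × toℕ j ≡ 0)

CycAdj : ∀ {m} → Fin m → Fin m → Set
CycAdj i j = CycSucc i j ⊎ CycSucc j i

DoubleCycle : ∀ {m} → MG m → Set
DoubleCycle {m} H =
  (Σ (m ≡ 2) λ _ → ∀ a b → a ≢ b → mult H a b ≡ 4)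
  ⊎ (3 ≤ m × ∃ λ (σ : Fin m → Fin m) → Injective _≡_ _≡_ σ ×
       (∀ i j → (CycAdj i j → mult H (σ i) (σ j) ≡ 2)
              × (¬ CycAdj i j → mult H (σ i) (σ j) ≡ 0)))

module Submission where

-- Contracting a proper tight set S with r ∉ S keeps the graph 4-regular (the new vertex has
-- degree |∂S| = 4) and 4-edge-connected (every cut of the contraction is a cut of G), and
-- keeps a double edge at r: it survives the contraction, and no multiplicity exceeds 2 in a
-- 4-regular 4-edge-connected graph with a third vertex.  So the final graph G has these
-- properties and no uncrossed proper tight set.  In such a graph every double edge ab
-- continues, i.e. a has a second double neighbour.  With three vertices this is arithmetic.
-- Otherwise, if b were the only one, the tight pair {a,b} is crossed by a tight set; by
-- submodularity of ∂, crossing tight sets can be uncrossed into smaller tight sets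
-- containing a but not b, an infinite descent.  Following double edges from r therefore
-- traces a closed walk; as each of its vertices spends all four edges on its two walk
-- neighbours, no edge leaves the walk, so by connectivity it covers G, a double cycle.

open import Defs
import Algebra.Properties.CommutativeMonoid.Sum as CommutativeMonoidSum
open import Data.Bool using (Bool; true; false; if_then_else_; _∧_; _∨_; not)
import Data.Bool as Bool
open import Data.Bool.Properties using (not-injective; ∧-zeroʳ; ∧-identityʳ; ∨-zeroʳ)
open import Data.Empty using (⊥; ⊥-elim)
open import Data.Fin using (Fin; zero; suc; toℕ; fromℕ<; _≟_)
open import Data.Fin.Patterns using (0F; 1F; 2F)
import Data.Fin.Properties as Fin
open import Data.Fin.Subset using (Subset; _∈_; _∉_; ∣_∣; _∩_; _∪_; _─_; ∁)
open import Data.Fin.Subset.Properties using (_∈?_)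
open import Data.Nat using (ℕ; zero; suc; _+_; _*_; _≤_; _<_; z≤n; s≤s)
import Data.Nat as ℕ
open import Data.Nat.Properties hiding (_≟_)
open import Data.Product using (∃; _×_; _,_; proj₁; proj₂; map₂; swap)
open import Data.Sum using (_⊎_; inj₁; inj₂)
open import Data.Vec using ([]; _∷_; lookup; tabulate)
open import Data.Vec.Properties using (lookup∘tabulate; []=⇒lookup; lookup⇒[]=; lookup-zipWith; lookup-map)
open import Function using (_∘_; id)
open import Function.Definitions using (Injective; Surjective)
open import Relation.Binary.Construct.Closure.ReflexiveTransitive using (Star; fold)
open import Relation.Binary.PropositionalEquality
open import Relation.Nullary using (¬_; does; yes; no; contradiction)
open import Relation.Nullary.Decidable using (dec-true; dec-false; _×-dec_; ¬?)

module ℕSum = CommutativeMonoidSum +-0-commutativeMonoid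

∑≡sum : ∀ {n} (f : Fin n → ℕ) → ∑ f ≡ ℕSum.sum f
∑≡sum {zero}  f = refl
∑≡sum {suc n} f = cong (f zero +_) (∑≡sum (f ∘ suc))

∑-cong : ∀ {n} {f g : Fin n → ℕ} → f ≗ g → ∑ f ≡ ∑ g
∑-cong {f = f} {g} f≗g = trans (∑≡sum f) (trans (ℕSum.sum-cong-≗ f≗g) (sym (∑≡sum g)))

∑-distrib-+ : ∀ {n} (f g : Fin n → ℕ) → ∑ (λ i → f i + g i) ≡ ∑ f + ∑ g
∑-distrib-+ f g = begin
  ∑ (λ i → f i + g i)        ≡⟨ ∑≡sum (λ i → f i + g i) ⟩
  ℕSum.sum (λ i → f i + g i) ≡⟨ ℕSum.∑-distrib-+ f g ⟩
  ℕSum.sum f + ℕSum.sum g    ≡⟨ cong₂ _+_ (∑≡sum f) (∑≡sum g) ⟨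
  ∑ f + ∑ g                  ∎
  where open ≡-Reasoning

∑-comm : ∀ {m n} (f : Fin m → Fin n → ℕ) → ∑ (λ i → ∑ (f i)) ≡ ∑ (λ j → ∑ (λ i → f i j))
∑-comm f = begin
  ∑ (λ i → ∑ (f i))                       ≡⟨ ∑∑≡sumsum f ⟩
  ℕSum.sum (λ i → ℕSum.sum (f i))         ≡⟨ ℕSum.∑-comm f ⟩
  ℕSum.sum (λ j → ℕSum.sum (λ i → f i j)) ≡⟨ ∑∑≡sumsum (λ j i → f i j) ⟨
  ∑ (λ j → ∑ (λ i → f i j))               ∎
  where
  open ≡-Reasoning
  ∑∑≡sumsum : ∀ {m n} (g : Fin m → Fin n → ℕ) → ∑ (λ i → ∑ (g i)) ≡ ℕSum.sum (λ i → ℕSum.sum (g i))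
  ∑∑≡sumsum g = trans (∑-cong (∑≡sum ∘ g)) (∑≡sum (λ i → ℕSum.sum (g i)))

∑-zero : ∀ n → ∑ {n} (λ _ → 0) ≡ 0
∑-zero n = trans (∑≡sum {n} (λ _ → 0)) (ℕSum.sum-replicate-zero n)

∑-one : ∀ n → ∑ {n} (λ _ → 1) ≡ n
∑-one zero    = refl
∑-one (suc n) = cong suc (∑-one n)

∑-mono-≤ : ∀ {n} {f g : Fin n → ℕ} → (∀ i → f i ≤ g i) → ∑ f ≤ ∑ g
∑-mono-≤ {zero}  f≤g = z≤n
∑-mono-≤ {suc n} f≤g = +-mono-≤ (f≤g zero) (∑-mono-≤ (f≤g ∘ suc))

∑-mono-< : ∀ {n} {f g : Fin n → ℕ} → (∀ i → f i ≤ g i) → ∀ a → f a < g a → ∑ f < ∑ g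
∑-mono-< f≤g zero    fa<ga = +-mono-<-≤ fa<ga (∑-mono-≤ (f≤g ∘ suc))
∑-mono-< f≤g (suc a) fa<ga = +-mono-≤-< (f≤g zero) (∑-mono-< (f≤g ∘ suc) a fa<ga)

term≤∑ : ∀ {n} (f : Fin n → ℕ) a → f a ≤ ∑ f
term≤∑ f zero    = m≤m+n _ _
term≤∑ f (suc a) = ≤-trans (term≤∑ (f ∘ suc) a) (m≤n+m _ _)

∑-pos⇒∃ : ∀ {n} (f : Fin n → ℕ) → 0 < ∑ f → ∃ λ x → 0 < f x
∑-pos⇒∃ {suc n} f pos with f zero in f₀≡
... | suc _ = zero , subst (0 <_) (sym f₀≡) (s≤s z≤n)
... | zero  with ∑-pos⇒∃ (f ∘ suc) pos
...   | x , 0<fx = suc x , 0<fx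

∑∑-cong : ∀ {m n} {f g : Fin m → Fin n → ℕ} → (∀ i j → f i j ≡ g i j) →
          ∑ (λ i → ∑ (f i)) ≡ ∑ (λ i → ∑ (g i))
∑∑-cong f≡g = ∑-cong (λ i → ∑-cong (f≡g i))

∑∑-mono-≤ : ∀ {m n} {f g : Fin m → Fin n → ℕ} → (∀ i j → f i j ≤ g i j) →
            ∑ (λ i → ∑ (f i)) ≤ ∑ (λ i → ∑ (g i))
∑∑-mono-≤ f≤g = ∑-mono-≤ (λ i → ∑-mono-≤ (f≤g i))

∑∑-distrib-+ : ∀ {m n} (f g : Fin m → Fin n → ℕ) →
               ∑ (λ i → ∑ (λ j → f i j + g i j)) ≡ ∑ (λ i → ∑ (f i)) + ∑ (λ i → ∑ (g i))
∑∑-distrib-+ f g = trans (∑-cong (λ i → ∑-distrib-+ (f i) (g i))) (∑-distrib-+ (λ i → ∑ (f i)) (λ i → ∑ (g i)))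

term≤∑∑ : ∀ {m n} (f : Fin m → Fin n → ℕ) a b → f a b ≤ ∑ (λ i → ∑ (f i))
term≤∑∑ f a b = ≤-trans (term≤∑ (f a) b) (term≤∑ (λ i → ∑ (f i)) a)

if-∧ : ∀ (p q : Bool) (k : ℕ) → (if p ∧ q then k else 0) ≡ (if p then (if q then k else 0) else 0)
if-∧ true  q k = refl
if-∧ false q k = refl

if-comm : ∀ (p q : Bool) (k : ℕ) → (if p then (if q then k else 0) else 0) ≡ (if q then (if p then k else 0) else 0)
if-comm true  true  k = refl
if-comm true  false k = refl
if-comm false true  k = refl
if-comm false false k = refl

∑-if : ∀ {n} b (f : Fin n → ℕ) → ∑ (λ i → if b then f i else 0) ≡ (if b then ∑ f else 0)
∑-if     true  f = refl
∑-if {n} false f = ∑-zero n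

∑∑-if : ∀ {m n} b (f : Fin m → Fin n → ℕ) →
        ∑ (λ i → ∑ (λ j → if b then f i j else 0)) ≡ (if b then ∑ (λ i → ∑ (f i)) else 0)
∑∑-if b f = trans (∑-cong (λ i → ∑-if b (f i))) (∑-if b (λ i → ∑ (f i)))

δ : ∀ {n} → Fin n → Fin n → Bool
δ a x = does (a ≟ x)

δ-refl : ∀ {n} (a : Fin n) → δ a a ≡ true
δ-refl a = dec-true (a ≟ a) refl

δ-≢ : ∀ {n} {a x : Fin n} → a ≢ x → δ a x ≡ false
δ-≢ {a = a} {x} = dec-false (a ≟ x)

δ⇒≡ : ∀ {n} {a x : Fin n} → δ a x ≡ true → a ≡ x
δ⇒≡ {a = a} {x} _ with a ≟ x
... | yes a≡x = a≡x

δ≡false⇒≢ : ∀ {n} {a x : Fin n} → δ a x ≡ false → a ≢ x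
δ≡false⇒≢ {a = a} a≉x refl = contradiction (trans (sym (δ-refl a)) a≉x) λ ()

∑-select : ∀ {n} (f : Fin n → ℕ) a → ∑ (λ x → if δ a x then f x else 0) ≡ f a
∑-select {suc n} f zero    = trans (cong (f zero +_) (∑-zero n)) (+-identityʳ _)
∑-select {suc n} f (suc a) = ∑-select (f ∘ suc) a

∑∑-select : ∀ {m n} (g : Fin m → Fin n → ℕ) a b → ∑ (λ u → ∑ (λ v → if δ a u ∧ δ b v then g u v else 0)) ≡ g a b
∑∑-select {m} {n} g a b = begin
  ∑ (λ u → ∑ (λ v → if δ a u ∧ δ b v then g u v else 0))                 ≡⟨ ∑∑-cong (λ u v → if-∧ (δ a u) (δ b v) (g u v)) ⟩
  ∑ (λ u → ∑ (λ v → if δ a u then (if δ b v then g u v else 0) else 0)) ≡⟨ ∑-cong (λ u → ∑-if (δ a u) (g-at u)) ⟩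
  ∑ (λ u → if δ a u then ∑ (g-at u) else 0)                              ≡⟨ ∑-select (∑ ∘ g-at) a ⟩
  ∑ (g-at a)                                                             ≡⟨ ∑-select (g a) b ⟩
  g a b                                                                  ∎
  where
  open ≡-Reasoning
  g-at : Fin m → Fin n → ℕ
  g-at u v = if δ b v then g u v else 0

_without_ : ∀ {n} → (Fin n → ℕ) → Fin n → Fin n → ℕ
(f without a) x = if δ a x then 0 else f x

∑-without : ∀ {n} (f : Fin n → ℕ) a → ∑ f ≡ f a + ∑ (f without a)
∑-without f a = begin
  ∑ f                                                         ≡⟨ ∑-cong split ⟩
  ∑ (λ x → (if δ a x then f x else 0) + (f without a) x)      ≡⟨ ∑-distrib-+ (λ x → if δ a x then f x else 0) (f without a) ⟩
  ∑ (λ x → if δ a x then f x else 0) + ∑ (f without a)        ≡⟨ cong (_+ ∑ (f without a)) (∑-select f a) ⟩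
  f a + ∑ (f without a)                                       ∎
  where
  open ≡-Reasoning
  split : ∀ x → f x ≡ (if δ a x then f x else 0) + (f without a) x
  split x with δ a x
  ... | true  = sym (+-identityʳ _)
  ... | false = refl

without-pos : ∀ {n} (f : Fin n → ℕ) a x → 0 < (f without a) x → x ≢ a × 0 < f x
without-pos f a x pos with a ≟ x
... | yes _   = contradiction pos λ ()
... | no a≢x = a≢x ∘ sym , pos

∑-two : ∀ {n} (f : Fin n → ℕ) {a b} → a ≢ b → f a + f b ≤ ∑ f
∑-two f {a} {b} a≢b = begin
  f a + f b                 ≡⟨ cong (λ t → f a + (if t then 0 else f b)) (δ-≢ a≢b) ⟨
  f a + (f without a) b     ≤⟨ +-monoʳ-≤ (f a) (term≤∑ (f without a) b) ⟩
  f a + ∑ (f without a)     ≡⟨ ∑-without f a ⟨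
  ∑ f                       ∎
  where open ≤-Reasoning

∑-three : ∀ {n} (f : Fin n → ℕ) {a b c} → a ≢ b → a ≢ c → b ≢ c → f a + f b + f c ≤ ∑ f
∑-three f {a} {b} {c} a≢b a≢c b≢c = begin
  f a + f b + f c                               ≡⟨ +-assoc (f a) _ _ ⟩
  f a + (f b + f c)                             ≡⟨ cong₂ (λ s t → f a + ((if s then 0 else f b) + (if t then 0 else f c)))
                                                         (δ-≢ a≢b) (δ-≢ a≢c) ⟨
  f a + ((f without a) b + (f without a) c)     ≤⟨ +-monoʳ-≤ (f a) (∑-two (f without a) b≢c) ⟩
  f a + ∑ (f without a)                         ≡⟨ ∑-without f a ⟨
  ∑ f                                           ∎
  where open ≤-Reasoning

⁅_⁆ : ∀ {n} → Fin n → Fin n → Bool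
⁅ a ⁆ x = δ a x

∁ᵇ : ∀ {n} → (Fin n → Bool) → Fin n → Bool
∁ᵇ P x = not (P x)

_∩ᵇ_ _∪ᵇ_ : ∀ {n} → (Fin n → Bool) → (Fin n → Bool) → Fin n → Bool
(P ∩ᵇ Q) x = P x ∧ Q x
(P ∪ᵇ Q) x = P x ∨ Q x

_-ᵇ_ : ∀ {n} → (Fin n → Bool) → Fin n → Fin n → Bool
(P -ᵇ a) x = P x ∧ not (δ a x)

_⊆ᵇ_ : ∀ {n} → (Fin n → Bool) → (Fin n → Bool) → Set
P ⊆ᵇ Q = ∀ x → P x ≡ true → Q x ≡ true

∧≡true⇒ : ∀ {p q} → p ∧ q ≡ true → p ≡ true × q ≡ true
∧≡true⇒ {true} {true} _ = refl , refl

∨≡false⇒ : ∀ {p q} → p ∨ q ≡ false → p ≡ false × q ≡ false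
∨≡false⇒ {false} {false} _ = refl , refl

count : ∀ {n} → (Fin n → Bool) → ℕ
count P = ∑ λ x → if P x then 1 else 0

count-cong : ∀ {n} {P Q : Fin n → Bool} → P ≗ Q → count P ≡ count Q
count-cong P≗Q = ∑-cong (λ x → cong (λ b → if b then 1 else 0) (P≗Q x))

count-∁ : ∀ {n} (P : Fin n → Bool) → count P + count (∁ᵇ P) ≡ n
count-∁ {n} P = begin
  count P + count (∁ᵇ P)                                          ≡⟨ ∑-distrib-+ (λ x → if P x then 1 else 0) _ ⟨
  ∑ (λ x → (if P x then 1 else 0) + (if not (P x) then 1 else 0)) ≡⟨ ∑-cong one ⟩
  ∑ {n} (λ _ → 1)                                                 ≡⟨ ∑-one n ⟩
  n                                                               ∎
  where
  open ≡-Reasoning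
  one : ∀ x → (if P x then 1 else 0) + (if not (P x) then 1 else 0) ≡ 1
  one x with P x
  ... | true  = refl
  ... | false = refl

count-mono-< : ∀ {n} {P Q : Fin n → Bool} → P ⊆ᵇ Q → ∀ a → P a ≡ false → Q a ≡ true → count P < count Q
count-mono-< {P = P} {Q} P⊆Q a Pa Qa =
  ∑-mono-< pointwise a (subst₂ (λ p q → (if p then 1 else 0) < (if q then 1 else 0)) (sym Pa) (sym Qa) ≤-refl)
  where
  pointwise : ∀ x → (if P x then 1 else 0) ≤ (if Q x then 1 else 0)
  pointwise x with P x in Px
  ... | true  rewrite P⊆Q x Px = ≤-refl
  ... | false = z≤n

count-pos : ∀ {n} (P : Fin n → Bool) {a} → P a ≡ true → 0 < count P
count-pos P {a} Pa = ≤-trans (≤-reflexive (cong (λ b → if b then 1 else 0) (sym Pa))) (term≤∑ (λ x → if P x then 1 else 0) a)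

count-<n : ∀ {n} (P : Fin n → Bool) {a} → P a ≡ false → count P < n
count-<n P Pa = subst (count P <_) (count-∁ P) (m<m+n (count P) (count-pos (∁ᵇ P) (cong not Pa)))

count-two : ∀ {n} (P : Fin n → Bool) {a b} → a ≢ b → P a ≡ true → P b ≡ true → 2 ≤ count P
count-two P a≢b Pa Pb =
  subst₂ (λ p q → (if p then 1 else 0) + (if q then 1 else 0) ≤ count P) Pa Pb (∑-two (λ x → if P x then 1 else 0) a≢b)

count-pair≤2 : ∀ {n} (a b : Fin n) → count (⁅ a ⁆ ∪ᵇ ⁅ b ⁆) ≤ 2
count-pair≤2 a b = begin
  count (⁅ a ⁆ ∪ᵇ ⁅ b ⁆)                                         ≤⟨ ∑-mono-≤ (λ x → pointwise (δ a x) (δ b x)) ⟩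
  ∑ (λ x → (if δ a x then 1 else 0) + (if δ b x then 1 else 0)) ≡⟨ ∑-distrib-+ (λ x → if δ a x then 1 else 0) _ ⟩
  count ⁅ a ⁆ + count ⁅ b ⁆                                      ≡⟨ cong₂ _+_ (∑-select (λ _ → 1) a) (∑-select (λ _ → 1) b) ⟩
  2                                                              ∎
  where
  open ≤-Reasoning
  pointwise : ∀ p q → (if p ∨ q then 1 else 0) ≤ (if p then 1 else 0) + (if q then 1 else 0)
  pointwise true  q = s≤s z≤n
  pointwise false q = ≤-refl

if-1-pos : ∀ b → 0 < (if b then 1 else 0) → b ≡ true
if-1-pos true _ = refl

count-pos⇒∃ : ∀ {n} (P : Fin n → Bool) → 0 < count P → ∃ λ x → P x ≡ true
count-pos⇒∃ P pos = let x , 0<Px = ∑-pos⇒∃ (λ x → if P x then 1 else 0) pos in x , if-1-pos (P x) 0<Px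

count-<n⇒∃ : ∀ {n} (P : Fin n → Bool) → count P < n → ∃ λ x → P x ≡ false
count-<n⇒∃ P P<n = let x , ¬Px = count-pos⇒∃ (∁ᵇ P) 0<∁P in x , not-injective ¬Px
  where
  0<∁P : 0 < count (∁ᵇ P)
  0<∁P = +-cancelˡ-< (count P) 0 _ (subst₂ _<_ (sym (+-identityʳ _)) (sym (count-∁ P)) P<n)

count≥2⇒other : ∀ {n} (P : Fin n → Bool) → 2 ≤ count P → ∀ a → ∃ λ x → P x ≡ true × x ≢ a
count≥2⇒other {n} P 2≤P a =
  let x , pos = ∑-pos⇒∃ (indicator without a) rest>0
      x≢a , 0<Px = without-pos indicator a x pos
  in x , if-1-pos (P x) 0<Px , x≢a
  where
  indicator : Fin n → ℕ
  indicator x = if P x then 1 else 0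
  indicator≤1 : ∀ b → (if b then 1 else 0) ≤ 1
  indicator≤1 true  = ≤-refl
  indicator≤1 false = z≤n
  rest>0 : 0 < ∑ (indicator without a)
  rest>0 = +-cancelˡ-< 1 0 _ (≤-trans 2≤P (≤-trans (≤-reflexive (∑-without indicator a)) (+-monoˡ-≤ _ (indicator≤1 (P a)))))

outside-pair : ∀ {n} → 2 < n → ∀ (a b : Fin n) → ∃ λ c → a ≢ c × b ≢ c
outside-pair 2<n a b =
  let c , pair-c = count-<n⇒∃ (⁅ a ⁆ ∪ᵇ ⁅ b ⁆) (≤-trans (s≤s (count-pair≤2 a b)) 2<n)
      a≉c , b≉c = ∨≡false⇒ pair-c
  in c , δ≡false⇒≢ a≉c , δ≡false⇒≢ b≉c

three-distinct⇒3≤n : ∀ {n} {a b c : Fin n} → a ≢ b → a ≢ c → b ≢ c → 3 ≤ n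
three-distinct⇒3≤n {n} a≢b a≢c b≢c = subst (3 ≤_) (∑-one n) (∑-three (λ _ → 1) a≢b a≢c b≢c)

-- Cuts

∂ : ∀ {n} → MG n → (Fin n → Bool) → ℕ
∂ G P = ∑ λ u → ∑ λ v → if P u ∧ not (P v) then mult G u v else 0

edges : ∀ {n} → MG n → (Fin n → Bool) → (Fin n → Bool) → ℕ
edges G P Q = ∑ λ u → ∑ λ v → if P u ∧ Q v then mult G u v else 0

∂-cong : ∀ {n} (G : MG n) {P Q : Fin n → Bool} → P ≗ Q → ∂ G P ≡ ∂ G Q
∂-cong G P≗Q = ∑∑-cong (λ u v → cong₂ (λ p q → if p ∧ not q then mult G u v else 0) (P≗Q u) (P≗Q v))

∂-∁ : ∀ {n} (G : MG n) (P : Fin n → Bool) → ∂ G (∁ᵇ P) ≡ ∂ G P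
∂-∁ G P = trans (∑-comm (λ u v → if not (P u) ∧ not (not (P v)) then mult G u v else 0)) (∑∑-cong reversed)
  where
  reversed : ∀ v u → (if not (P u) ∧ not (not (P v)) then mult G u v else 0) ≡ (if P v ∧ not (P u) then mult G v u else 0)
  reversed v u with P u | P v
  ... | true  | true  = refl
  ... | true  | false = refl
  ... | false | true  = mult-sym G u v
  ... | false | false = refl

∂-submodular : ∀ {n} (G : MG n) (P Q : Fin n → Bool) → ∂ G (P ∩ᵇ Q) + ∂ G (P ∪ᵇ Q) ≤ ∂ G P + ∂ G Q
∂-submodular {n} G P Q = begin
  ∂ G (P ∩ᵇ Q) + ∂ G (P ∪ᵇ Q)
    ≡⟨ ∑∑-distrib-+ (leaving (P ∩ᵇ Q)) (leaving (P ∪ᵇ Q)) ⟨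
  ∑ (λ u → ∑ (λ v → leaving (P ∩ᵇ Q) u v + leaving (P ∪ᵇ Q) u v))
    ≤⟨ ∑∑-mono-≤ (λ u v → pointwise (P u) (Q u) (P v) (Q v) (mult G u v)) ⟩
  ∑ (λ u → ∑ (λ v → leaving P u v + leaving Q u v))
    ≡⟨ ∑∑-distrib-+ (leaving P) (leaving Q) ⟩
  ∂ G P + ∂ G Q ∎
  where
  open ≤-Reasoning
  leaving : (Fin n → Bool) → Fin n → Fin n → ℕ
  leaving R u v = if R u ∧ not (R v) then mult G u v else 0
  pointwise : ∀ pu qu pv qv k →
    (if (pu ∧ qu) ∧ not (pv ∧ qv) then k else 0) + (if (pu ∨ qu) ∧ not (pv ∨ qv) then k else 0)
    ≤ (if pu ∧ not pv then k else 0) + (if qu ∧ not qv then k else 0)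
  pointwise true  true  true  true  k = z≤n
  pointwise true  true  true  false k = ≤-reflexive (+-identityʳ k)
  pointwise true  true  false true  k = ≤-refl
  pointwise true  true  false false k = ≤-refl
  pointwise true  false true  _     k = z≤n
  pointwise true  false false true  k = z≤n
  pointwise true  false false false k = ≤-reflexive (sym (+-identityʳ k))
  pointwise false true  true  _     k = z≤n
  pointwise false true  false true  k = z≤n
  pointwise false true  false false k = ≤-refl
  pointwise false false _     _     k = z≤n

∂-∪-disjoint : ∀ {n} (G : MG n) (P Q : Fin n → Bool) → (∀ x → P x ∧ Q x ≡ false) →
               ∂ G (P ∪ᵇ Q) + (edges G P Q + edges G Q P) ≡ ∂ G P + ∂ G Q
∂-∪-disjoint {n} G P Q disjoint = begin
  ∂ G (P ∪ᵇ Q) + (edges G P Q + edges G Q P)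
    ≡⟨ cong (∂ G (P ∪ᵇ Q) +_) (∑∑-distrib-+ (between P Q) (between Q P)) ⟨
  ∂ G (P ∪ᵇ Q) + ∑ (λ u → ∑ (λ v → between P Q u v + between Q P u v))
    ≡⟨ ∑∑-distrib-+ (leaving (P ∪ᵇ Q)) (λ u v → between P Q u v + between Q P u v) ⟨
  ∑ (λ u → ∑ (λ v → leaving (P ∪ᵇ Q) u v + (between P Q u v + between Q P u v)))
    ≡⟨ ∑∑-cong (λ u v → pointwise (P u) (Q u) (P v) (Q v) (mult G u v) (disjoint u) (disjoint v)) ⟩
  ∑ (λ u → ∑ (λ v → leaving P u v + leaving Q u v))
    ≡⟨ ∑∑-distrib-+ (leaving P) (leaving Q) ⟩
  ∂ G P + ∂ G Q ∎
  where
  open ≡-Reasoning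
  leaving : (Fin n → Bool) → Fin n → Fin n → ℕ
  leaving R u v = if R u ∧ not (R v) then mult G u v else 0
  between : (Fin n → Bool) → (Fin n → Bool) → Fin n → Fin n → ℕ
  between R R′ u v = if R u ∧ R′ v then mult G u v else 0
  pointwise : ∀ pu qu pv qv k → pu ∧ qu ≡ false → pv ∧ qv ≡ false →
    (if (pu ∨ qu) ∧ not (pv ∨ qv) then k else 0) + ((if pu ∧ qv then k else 0) + (if qu ∧ pv then k else 0))
    ≡ (if pu ∧ not pv then k else 0) + (if qu ∧ not qv then k else 0)
  pointwise true  false true  false k _ _ = refl
  pointwise true  false false true  k _ _ = refl
  pointwise true  false false false k _ _ = trans (+-identityʳ k) (sym (+-identityʳ k))
  pointwise false true  true  false k _ _ = refl
  pointwise false true  false true  k _ _ = refl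
  pointwise false true  false false k _ _ = +-identityʳ k
  pointwise false false true  false k _ _ = refl
  pointwise false false false true  k _ _ = refl
  pointwise false false false false k _ _ = refl

∂-⁅⁆ : ∀ {n} (G : MG n) x → ∂ G ⁅ x ⁆ ≡ deg G x
∂-⁅⁆ {n} G x = begin
  ∂ G ⁅ x ⁆                                         ≡⟨ ∑∑-cong (λ u v → if-∧ (δ x u) (not (δ x v)) (mult G u v)) ⟩
  ∑ (λ u → ∑ (λ v → if δ x u then leaving u v else 0)) ≡⟨ ∑-cong (λ u → ∑-if (δ x u) (leaving u)) ⟩
  ∑ (λ u → if δ x u then ∑ (leaving u) else 0)      ≡⟨ ∑-select (∑ ∘ leaving) x ⟩
  ∑ (leaving x)                                     ≡⟨ ∑-cong no-loop ⟩
  deg G x                                           ∎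
  where
  open ≡-Reasoning
  leaving : Fin n → Fin n → ℕ
  leaving u v = if not (δ x v) then mult G u v else 0
  no-loop : ∀ v → leaving x v ≡ mult G x v
  no-loop v with x ≟ v
  ... | yes refl = sym (loopless G x)
  ... | no _     = refl

∂-pair : ∀ {n} (G : MG n) {a b} → a ≢ b → ∂ G (⁅ a ⁆ ∪ᵇ ⁅ b ⁆) + 2 * mult G a b ≡ deg G a + deg G b
∂-pair G {a} {b} a≢b = begin
  ∂ G (⁅ a ⁆ ∪ᵇ ⁅ b ⁆) + 2 * mult G a b                                ≡⟨ cong (∂ G (⁅ a ⁆ ∪ᵇ ⁅ b ⁆) +_) twice ⟩
  ∂ G (⁅ a ⁆ ∪ᵇ ⁅ b ⁆) + (edges G ⁅ a ⁆ ⁅ b ⁆ + edges G ⁅ b ⁆ ⁅ a ⁆)   ≡⟨ ∂-∪-disjoint G ⁅ a ⁆ ⁅ b ⁆ disjoint ⟩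
  ∂ G ⁅ a ⁆ + ∂ G ⁅ b ⁆                                                ≡⟨ cong₂ _+_ (∂-⁅⁆ G a) (∂-⁅⁆ G b) ⟩
  deg G a + deg G b                                                    ∎
  where
  open ≡-Reasoning
  twice : 2 * mult G a b ≡ edges G ⁅ a ⁆ ⁅ b ⁆ + edges G ⁅ b ⁆ ⁅ a ⁆
  twice = trans (cong (mult G a b +_) (+-identityʳ _))
                (sym (cong₂ _+_ (∑∑-select (mult G) a b) (trans (∑∑-select (mult G) b a) (mult-sym G b a))))
  disjoint : ∀ x → δ a x ∧ δ b x ≡ false
  disjoint x with a ≟ x
  ... | yes refl = δ-≢ (a≢b ∘ sym)
  ... | no _     = refl

∈⇒lookup : ∀ {n} {S : Subset n} {x} → x ∈ S → lookup S x ≡ true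
∈⇒lookup = []=⇒lookup

lookup-∩ : ∀ {n} (p q : Subset n) x → lookup (p ∩ q) x ≡ lookup p x ∧ lookup q x
lookup-∩ p q x = lookup-zipWith _∧_ x p q

lookup-∪ : ∀ {n} (p q : Subset n) x → lookup (p ∪ q) x ≡ lookup p x ∨ lookup q x
lookup-∪ p q x = lookup-zipWith _∨_ x p q

lookup-∁ : ∀ {n} (p : Subset n) x → lookup (∁ p) x ≡ not (lookup p x)
lookup-∁ p x = lookup-map x not p

lookup-─ : ∀ {n} (p q : Subset n) x → lookup (p ─ q) x ≡ lookup p x ∧ not (lookup q x)
lookup-─ (s ∷ p) (true  ∷ q) zero    = sym (∧-zeroʳ s)
lookup-─ (s ∷ p) (false ∷ q) zero    = sym (∧-identityʳ s)
lookup-─ (_ ∷ p) (_ ∷ q)     (suc x) = lookup-─ p q x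

∣∣≡count : ∀ {n} (S : Subset n) → ∣ S ∣ ≡ count (lookup S)
∣∣≡count []          = refl
∣∣≡count (true ∷ S)  = cong suc (∣∣≡count S)
∣∣≡count (false ∷ S) = ∣∣≡count S

∣tabulate∣ : ∀ {n} (P : Fin n → Bool) → ∣ tabulate P ∣ ≡ count P
∣tabulate∣ P = trans (∣∣≡count (tabulate P)) (count-cong (lookup∘tabulate P))

cut-tabulate : ∀ {n} (G : MG n) (P : Fin n → Bool) → cut G (tabulate P) ≡ ∂ G P
cut-tabulate G P = ∂-cong G (lookup∘tabulate P)

isCutSet-tabulate : ∀ {n} (P : Fin n → Bool) {a b} → P a ≡ true → P b ≡ false → IsCutSet (tabulate P)
isCutSet-tabulate P Pa Pb = subst (0 <_) (sym (∣tabulate∣ P)) (count-pos P Pa) , subst (_< _) (sym (∣tabulate∣ P)) (count-<n P Pb)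

isCutSet⇒∃ : ∀ {n} (S : Subset n) → IsCutSet S → (∃ λ a → lookup S a ≡ true) × (∃ λ b → lookup S b ≡ false)
isCutSet⇒∃ S (0<∣S∣ , ∣S∣<n) =
  count-pos⇒∃ (lookup S) (subst (0 <_) (∣∣≡count S) 0<∣S∣) , count-<n⇒∃ (lookup S) (subst (_< _) (∣∣≡count S) ∣S∣<n)

edgeConnected⇒≤∂ : ∀ {n k} (G : MG n) → EdgeConnected k G → ∀ P {a b} → P a ≡ true → P b ≡ false → k ≤ ∂ G P
edgeConnected⇒≤∂ G connected P Pa Pb = subst (_ ≤_) (cut-tabulate G P) (connected (tabulate P) (isCutSet-tabulate P Pa Pb))

properTight-tabulate : ∀ {n k} (G : MG n) → EdgeConnected k G → ∀ P {a b} → P a ≡ true → P b ≡ false →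
                       2 ≤ count P → count P + 2 ≤ n → ∂ G P ≤ k → ProperTight G (tabulate P)
properTight-tabulate {n} G connected P Pa Pb 2≤P P+2≤n ∂P≤k =
  (subst (1 <_) (sym (∣tabulate∣ P)) 2≤P , subst (λ t → suc t < n) (sym (∣tabulate∣ P)) (subst (_≤ n) (+-comm (count P) 2) P+2≤n)) ,
  isCutSet-tabulate P Pa Pb , λ T T-cut → ≤-trans (≤-reflexive (cut-tabulate G P)) (≤-trans ∂P≤k (connected T T-cut))

Crossᵇ : ∀ {n} → (Fin n → Bool) → (Fin n → Bool) → Set
Crossᵇ P Q = (∃ λ x → P x ≡ true  × Q x ≡ true) × (∃ λ x → P x ≡ true  × Q x ≡ false)
           × (∃ λ x → P x ≡ false × Q x ≡ true) × (∃ λ x → P x ≡ false × Q x ≡ false)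

Cross⇒Crossᵇ : ∀ {n} {S T : Subset n} → Cross S T → Crossᵇ (lookup S) (lookup T)
Cross⇒Crossᵇ {S = S} {T} ((x , x∈S∩T) , (y , y∈S─T) , (z , z∈T─S) , (w , w∈∁S∪T)) =
  (x , ∧≡true⇒ (trans (sym (lookup-∩ S T x)) (∈⇒lookup x∈S∩T))) ,
  (y , map₂ not-injective (∧≡true⇒ (trans (sym (lookup-─ S T y)) (∈⇒lookup y∈S─T)))) ,
  (z , swap (map₂ not-injective (∧≡true⇒ (trans (sym (lookup-─ T S z)) (∈⇒lookup z∈T─S))))) ,
  (w , ∨≡false⇒ (not-injective (trans (cong not (sym (lookup-∪ S T w))) (trans (sym (lookup-∁ (S ∪ T) w)) (∈⇒lookup w∈∁S∪T)))))

Crossᵇ-cong : ∀ {n} {P Q Q′ : Fin n → Bool} → Q ≗ Q′ → Crossᵇ P Q → Crossᵇ P Q′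
Crossᵇ-cong Q≗Q′ ((x , Px , Qx) , (y , Py , Qy) , (z , Pz , Qz) , (w , Pw , Qw)) =
  (x , Px , trans (sym (Q≗Q′ x)) Qx) , (y , Py , trans (sym (Q≗Q′ y)) Qy) ,
  (z , Pz , trans (sym (Q≗Q′ z)) Qz) , (w , Pw , trans (sym (Q≗Q′ w)) Qw)

Crossᵇ-∁ : ∀ {n} {P Q : Fin n → Bool} → Crossᵇ P Q → Crossᵇ (∁ᵇ P) Q
Crossᵇ-∁ ((x , Px , Qx) , (y , Py , Qy) , (z , Pz , Qz) , (w , Pw , Qw)) =
  (z , cong not Pz , Qz) , (w , cong not Pw , Qw) , (x , cong not Px , Qx) , (y , cong not Py , Qy)

DoubleEdge : ∀ {n} → MG n → Fin n → Fin n → Set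
DoubleEdge G a b = mult G a b ≡ 2

DoubleEdge-sym : ∀ {n} (G : MG n) {a b} → DoubleEdge G a b → DoubleEdge G b a
DoubleEdge-sym G {a} {b} ab = trans (mult-sym G b a) ab

module FourRegularGraph {n} (G : MG n) (regular : FourRegular G) where

  double-edge-irrefl : ∀ a → ¬ DoubleEdge G a a
  double-edge-irrefl a aa≡2 with trans (sym (loopless G a)) aa≡2
  ... | ()

  beside-two-double-edges : ∀ {a b c v} → b ≢ c → DoubleEdge G a b → DoubleEdge G a c → v ≢ b → v ≢ c → mult G a v ≡ 0
  beside-two-double-edges {a} {b} {c} {v} b≢c ab ac v≢b v≢c = n≤0⇒n≡0 (+-cancelˡ-≤ 4 _ 0 (begin
    4 + mult G a v                       ≡⟨ cong (_+ mult G a v) (cong₂ _+_ ab ac) ⟨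
    mult G a b + mult G a c + mult G a v ≤⟨ ∑-three (mult G a) b≢c (v≢b ∘ sym) (v≢c ∘ sym) ⟩
    deg G a                              ≡⟨ regular a ⟩
    4 + 0                                ∎))
    where open ≤-Reasoning

  ∂-pair≡8 : ∀ {a b} → a ≢ b → ∂ G (⁅ a ⁆ ∪ᵇ ⁅ b ⁆) + 2 * mult G a b ≡ 4 + 4
  ∂-pair≡8 {a} {b} a≢b = trans (∂-pair G a≢b) (cong₂ _+_ (regular a) (regular b))

  double⇒∂-pair≡4 : ∀ {a b} → a ≢ b → DoubleEdge G a b → ∂ G (⁅ a ⁆ ∪ᵇ ⁅ b ⁆) ≡ 4
  double⇒∂-pair≡4 {a} {b} a≢b ab = +-cancelʳ-≡ 4 _ 4 (trans (cong (λ t → ∂ G (⁅ a ⁆ ∪ᵇ ⁅ b ⁆) + 2 * t) (sym ab)) (∂-pair≡8 a≢b))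

  ∂-pair≡4⇒double : ∀ {a b} → a ≢ b → ∂ G (⁅ a ⁆ ∪ᵇ ⁅ b ⁆) ≡ 4 → DoubleEdge G a b
  ∂-pair≡4⇒double {a} {b} a≢b ∂≡4 = *-cancelˡ-≡ _ 2 2 (+-cancelˡ-≡ 4 _ 4 (trans (cong (_+ 2 * mult G a b) (sym ∂≡4)) (∂-pair≡8 a≢b)))

  module _ (connected : EdgeConnected 4 G) where

    tight⇒cut≡4 : ∀ {S} → Tight G S → cut G S ≡ 4
    tight⇒cut≡4 {S} (S-cut , S-min) with isCutSet⇒∃ S S-cut
    ... | (a , Sa) , (b , Sb) = ≤-antisym (begin
           cut G S                ≤⟨ S-min (tabulate ⁅ a ⁆) (isCutSet-tabulate ⁅ a ⁆ (δ-refl a) (δ-≢ a≢b)) ⟩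
           cut G (tabulate ⁅ a ⁆) ≡⟨ cut-tabulate G ⁅ a ⁆ ⟩
           ∂ G ⁅ a ⁆              ≡⟨ ∂-⁅⁆ G a ⟩
           deg G a                ≡⟨ regular a ⟩
           4                      ∎) (connected S S-cut)
      where
      open ≤-Reasoning
      a≢b : a ≢ b
      a≢b refl = contradiction (trans (sym Sa) Sb) λ ()

    mult≤2 : ∀ {a b w} → a ≢ b → w ≢ a → w ≢ b → mult G a b ≤ 2
    mult≤2 {a} {b} {w} a≢b w≢a w≢b = *-cancelˡ-≤ 2 (+-cancelˡ-≤ 4 _ (2 * 2) (begin
      4 + 2 * mult G a b                       ≤⟨ +-monoˡ-≤ (2 * mult G a b) (edgeConnected⇒≤∂ G connected (⁅ a ⁆ ∪ᵇ ⁅ b ⁆) a∈ w∉) ⟩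
      ∂ G (⁅ a ⁆ ∪ᵇ ⁅ b ⁆) + 2 * mult G a b   ≡⟨ ∂-pair≡8 a≢b ⟩
      4 + 2 * 2                                ∎))
      where
      open ≤-Reasoning
      a∈ : δ a a ∨ δ b a ≡ true
      a∈ = cong (_∨ δ b a) (δ-refl a)
      w∉ : δ a w ∨ δ b w ≡ false
      w∉ = cong₂ _∨_ (δ-≢ (w≢a ∘ sym)) (δ-≢ (w≢b ∘ sym))

triangle-double-edges : (G : MG 3) → FourRegular G → ∀ {a b} → a ≢ b → DoubleEdge G a b
triangle-double-edges G regular = double
  where
  x y z : ℕ
  x = mult G 0F 1F
  y = mult G 0F 2F
  z = mult G 1F 2F
  x+y≡4 : x + y ≡ 4
  x+y≡4 = trans (trans (cong (x +_) (sym (+-identityʳ y))) (cong (_+ (x + (y + 0))) (sym (loopless G 0F)))) (regular 0F)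
  x+z≡4 : x + z ≡ 4
  x+z≡4 = trans (cong₂ _+_ (mult-sym G 0F 1F) (trans (sym (+-identityʳ z)) (cong (_+ (z + 0)) (sym (loopless G 1F))))) (regular 1F)
  y+z≡4 : y + z ≡ 4
  y+z≡4 = trans (cong₂ _+_ (mult-sym G 0F 2F) (trans (sym (+-identityʳ z))
                  (cong₂ _+_ (mult-sym G 1F 2F) (sym (trans (+-identityʳ _) (loopless G 2F)))))) (regular 2F)
  y≡z : y ≡ z
  y≡z = +-cancelˡ-≡ x y z (trans x+y≡4 (sym x+z≡4))
  y≡2 : y ≡ 2
  y≡2 = *-cancelˡ-≡ y 2 2 (trans (cong (y +_) (trans (+-identityʳ y) y≡z)) y+z≡4)
  z≡2 : z ≡ 2
  z≡2 = trans (sym y≡z) y≡2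
  x≡2 : x ≡ 2
  x≡2 = +-cancelʳ-≡ 2 x 2 (trans (cong (x +_) (sym y≡2)) x+y≡4)
  double : ∀ {a b} → a ≢ b → DoubleEdge G a b
  double {0F} {0F} a≢b = contradiction refl a≢b
  double {0F} {1F} _   = x≡2
  double {0F} {2F} _   = y≡2
  double {1F} {0F} _   = DoubleEdge-sym G x≡2
  double {1F} {1F} a≢b = contradiction refl a≢b
  double {1F} {2F} _   = z≡2
  double {2F} {0F} _   = DoubleEdge-sym G y≡2
  double {2F} {1F} _   = DoubleEdge-sym G z≡2
  double {2F} {2F} a≢b = contradiction refl a≢b

-- Contraction

module Contraction {n m} (G : MG n) (S : Subset n) (H : MG m) (φ : Fin n → Fin m)
                   (contraction : IsContraction G S H φ) where

  private
    φ-surjective : Surjective _≡_ _≡_ φ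
    φ-surjective = proj₁ contraction
    φ-fibres : ∀ x y → (φ x ≡ φ y → x ≡ y ⊎ (x ∈ S × y ∈ S)) × (x ≡ y ⊎ (x ∈ S × y ∈ S) → φ x ≡ φ y)
    φ-fibres = proj₁ (proj₂ contraction)
    φ-mult : ∀ a b → a ≢ b → mult H a b ≡ ∑ λ x → ∑ λ y → if δ (φ x) a ∧ δ (φ y) b then mult G x y else 0
    φ-mult = proj₂ (proj₂ contraction)

  φ-≢ : ∀ {x y} → x ≢ y → x ∉ S ⊎ y ∉ S → φ x ≢ φ y
  φ-≢ {x} {y} x≢y outside φx≡φy with proj₁ (φ-fibres x y) φx≡φy | outside
  ... | inj₁ x≡y       | _        = x≢y x≡y
  ... | inj₂ (x∈S , _) | inj₁ x∉S = x∉S x∈S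
  ... | inj₂ (_ , y∈S) | inj₂ y∉S = y∉S y∈S

  φ-≡ : ∀ {x y} → x ∈ S → y ∈ S → φ x ≡ φ y
  φ-≡ {x} {y} x∈S y∈S = proj₂ (φ-fibres x y) (inj₂ (x∈S , y∈S))

  preimage : ∀ a → ∃ λ x → φ x ≡ a
  preimage a = proj₁ (φ-surjective a) , proj₂ (φ-surjective a) refl

  ∂-contract : ∀ Q → ∂ H Q ≡ ∂ G (Q ∘ φ)
  ∂-contract Q = begin
    ∂ H Q                                                   ≡⟨ ∑∑-cong expand ⟩
    ∑ (λ a → ∑ (λ b → ∑ (λ x → ∑ (λ y → term a b x y))))    ≡⟨ ∑-cong (λ a → ∑∑∑-comm (term a)) ⟩
    ∑ (λ a → ∑ (λ x → ∑ (λ y → ∑ (λ b → term a b x y))))    ≡⟨ ∑∑∑-comm (λ a x y → ∑ (λ b → term a b x y)) ⟩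
    ∑ (λ x → ∑ (λ y → ∑ (λ a → ∑ (λ b → term a b x y))))    ≡⟨ ∑∑-cong collapse ⟩
    ∂ G (Q ∘ φ)                                             ∎
    where
    open ≡-Reasoning
    between : Fin m → Fin m → Fin n → Fin n → ℕ
    between a b x y = if δ (φ x) a ∧ δ (φ y) b then mult G x y else 0
    term : Fin m → Fin m → Fin n → Fin n → ℕ
    term a b x y = if Q a ∧ not (Q b) then between a b x y else 0
    ∑∑∑-comm : ∀ {k} (f : Fin k → Fin n → Fin n → ℕ) →
               ∑ (λ b → ∑ (λ x → ∑ (f b x))) ≡ ∑ (λ x → ∑ (λ y → ∑ (λ b → f b x y)))
    ∑∑∑-comm f = trans (∑-comm (λ b x → ∑ (f b x))) (∑-cong (λ x → ∑-comm (λ b → f b x)))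
    expand : ∀ a b → (if Q a ∧ not (Q b) then mult H a b else 0) ≡ ∑ (λ x → ∑ (λ y → term a b x y))
    expand a b = trans (crossing-mult (Q a) (Q b) refl refl) (sym (∑∑-if (Q a ∧ not (Q b)) (between a b)))
      where
      crossing-mult : ∀ p q → Q a ≡ p → Q b ≡ q →
        (if p ∧ not q then mult H a b else 0) ≡ (if p ∧ not q then ∑ (λ x → ∑ (between a b x)) else 0)
      crossing-mult true  false Qa Qb = φ-mult a b λ a≡b → contradiction (trans (sym Qa) (trans (cong Q a≡b) Qb)) λ ()
      crossing-mult true  true  _  _  = refl
      crossing-mult false _     _  _  = refl
    collapse : ∀ x y → ∑ (λ a → ∑ (λ b → term a b x y)) ≡ (if Q (φ x) ∧ not (Q (φ y)) then mult G x y else 0)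
    collapse x y = trans (∑∑-cong (λ a b → if-comm (Q a ∧ not (Q b)) (δ (φ x) a ∧ δ (φ y) b) (mult G x y)))
                         (∑∑-select (λ a b → if Q a ∧ not (Q b) then mult G x y else 0) (φ x) (φ y))

  edgeConnected-contract : ∀ {k} → EdgeConnected k G → EdgeConnected k H
  edgeConnected-contract G-connected T T-cut with isCutSet⇒∃ T T-cut
  ... | (a , Ta) , (b , Tb) with preimage a | preimage b
  ...   | x , refl | y , refl = subst (_ ≤_) (sym (∂-contract (lookup T))) (edgeConnected⇒≤∂ G G-connected (lookup T ∘ φ) Ta Tb)

  deg-contract-∈ : ∀ {s} → s ∈ S → deg H (φ s) ≡ cut G S
  deg-contract-∈ {s} s∈S = trans (sym (∂-⁅⁆ H (φ s))) (trans (∂-contract ⁅ φ s ⁆) (∂-cong G fibre))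
    where
    fibre : ∀ y → δ (φ s) (φ y) ≡ lookup S y
    fibre y with lookup S y in Sy
    ... | true  = dec-true (φ s ≟ φ y) (φ-≡ s∈S (lookup⇒[]= y S Sy))
    ... | false = δ-≢ (φ-≢ (λ { refl → y∉S s∈S }) (inj₂ y∉S))
      where
      y∉S : y ∉ S
      y∉S y∈S = contradiction (trans (sym (∈⇒lookup y∈S)) Sy) λ ()

  deg-contract-∉ : ∀ {x} → x ∉ S → deg H (φ x) ≡ deg G x
  deg-contract-∉ {x} x∉S = trans (sym (∂-⁅⁆ H (φ x))) (trans (∂-contract ⁅ φ x ⁆) (trans (∂-cong G fibre) (∂-⁅⁆ G x)))
    where
    fibre : ∀ y → δ (φ x) (φ y) ≡ δ x y
    fibre y with x ≟ y
    ... | yes refl = δ-refl (φ x)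
    ... | no x≢y   = δ-≢ (φ-≢ x≢y (inj₁ x∉S))

  fourRegular-contract : FourRegular G → EdgeConnected 4 G → Tight G S → FourRegular H
  fourRegular-contract regular connected S-tight a with preimage a
  ... | x , refl with x ∈? S
  ...   | yes x∈S = trans (deg-contract-∈ x∈S) (FourRegularGraph.tight⇒cut≡4 G regular connected {S} S-tight)
  ...   | no  x∉S = trans (deg-contract-∉ x∉S) (regular x)

  mult-contract-≥ : ∀ {x y} → φ x ≢ φ y → mult G x y ≤ mult H (φ x) (φ y)
  mult-contract-≥ {x} {y} φx≢φy = begin
    mult G x y                            ≡⟨ cong₂ (λ p q → if p ∧ q then mult G x y else 0) (δ-refl (φ x)) (δ-refl (φ y)) ⟨
    fibres x y                            ≤⟨ term≤∑∑ fibres x y ⟩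
    ∑ (λ x′ → ∑ (λ y′ → fibres x′ y′))    ≡⟨ φ-mult (φ x) (φ y) φx≢φy ⟨
    mult H (φ x) (φ y)                    ∎
    where
    open ≤-Reasoning
    fibres : Fin n → Fin n → ℕ
    fibres x′ y′ = if δ (φ x′) (φ x) ∧ δ (φ y′) (φ y) then mult G x′ y′ else 0

-- The invariant of the procedure

record Invariant {n} (G : MG n) (r : Fin n) : Set where
  field
    regular       : FourRegular G
    connected     : EdgeConnected 4 G
    partner       : Fin n
    r≢partner     : r ≢ partner
    double        : DoubleEdge G r partner
    third         : Fin n
    third≢r       : third ≢ r
    third≢partner : third ≢ partner

InvariantOn : State → Set
InvariantOn (n , G , r) = Invariant G r

step-preserves-invariant : ∀ {s t} → Step s t → InvariantOn s → InvariantOn t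
step-preserves-invariant {n , _ , _} {m , _ , _} (step G r S H φ ((((S-proper , S-tight) , _) , r∉S) , _) contraction) inv = record
  { regular       = H-regular
  ; connected     = H-connected
  ; partner       = φ partner
  ; r≢partner     = φr≢φu
  ; double        = ≤-antisym (FourRegularGraph.mult≤2 H H-regular H-connected φr≢φu w≢φr w≢φu)
                              (subst (_≤ _) double (mult-contract-≥ φr≢φu))
  ; third         = w
  ; third≢r       = w≢φr
  ; third≢partner = w≢φu
  }
  where
  open Invariant inv
  open Contraction G S H φ contraction
  H-regular : FourRegular H
  H-regular = fourRegular-contract regular connected S-tight
  H-connected : EdgeConnected 4 H
  H-connected = edgeConnected-contract connected
  φr≢φu : φ r ≢ φ partner
  φr≢φu = φ-≢ r≢partner (inj₁ r∉S)
  2≤∣S∣ : 2 ≤ count (lookup S)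
  2≤∣S∣ = subst (2 ≤_) (∣∣≡count S) (proj₁ S-proper)
  2≤∣∁S∣ : 2 ≤ count (∁ᵇ (lookup S))
  2≤∣∁S∣ = +-cancelˡ-≤ (count (lookup S)) 2 _
             (subst₂ _≤_ (trans (+-comm 2 _) (cong (_+ 2) (∣∣≡count S))) (sym (count-∁ (lookup S))) (proj₂ S-proper))
  third′ : ∃ λ w → w ≢ φ r × w ≢ φ partner
  third′ with partner ∈? S
  ... | yes u∈S =
    let y , ¬Sy , y≢r = count≥2⇒other (∁ᵇ (lookup S)) 2≤∣∁S∣ r
        y∉S = λ y∈S → contradiction (trans (sym (∈⇒lookup y∈S)) (not-injective ¬Sy)) λ ()
    in φ y , φ-≢ y≢r (inj₁ y∉S) , φ-≢ (λ { refl → y∉S u∈S }) (inj₁ y∉S)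
  ... | no u∉S =
    let s , Ss = count-pos⇒∃ (lookup S) (≤-trans (s≤s z≤n) 2≤∣S∣)
        s∈S = lookup⇒[]= s S Ss
    in φ s , φ-≢ (λ { refl → r∉S s∈S }) (inj₂ r∉S) , φ-≢ (λ { refl → u∉S s∈S }) (inj₂ u∉S)
  w : Fin m
  w = proj₁ third′
  w≢φr : w ≢ φ r
  w≢φr = proj₁ (proj₂ third′)
  w≢φu : w ≢ φ partner
  w≢φu = proj₂ (proj₂ third′)

Star-preserves-invariant : ∀ {s t} → Star Step s t → InvariantOn s → InvariantOn t
Star-preserves-invariant =
  fold (λ s t → InvariantOn s → InvariantOn t) (λ s→t preserved → preserved ∘ step-preserves-invariant s→t) id

-- Terminal graphs

DoubleEdgesContinue : ∀ {m} → MG m → Set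
DoubleEdgesContinue G = ∀ {a b} → DoubleEdge G a b → ∃ λ c → c ≢ b × DoubleEdge G a c

module TerminalGraph {m} (G : MG m) (regular : FourRegular G) (connected : EdgeConnected 4 G) (terminal : Terminal G) where

  open FourRegularGraph G regular

  crossed-through : ∀ C a → ProperTight G (tabulate C) → (∀ Q → ∂ G Q ≡ 4 → Q a ≡ true → Crossᵇ Q C → ⊥) → ⊥
  crossed-through C a C-tight uncrossable = terminal (tabulate C , C-tight , λ T T-tight T×C →
    orient (lookup T) (tight⇒cut≡4 connected {T} (proj₂ T-tight)) (Crossᵇ-cong (lookup∘tabulate C) (Cross⇒Crossᵇ T×C)))
    where
    orient : ∀ Q → ∂ G Q ≡ 4 → Crossᵇ Q C → ⊥
    orient Q ∂Q≡4 Q×C with Q a in Qa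
    ... | true  = uncrossable Q ∂Q≡4 Qa Q×C
    ... | false = uncrossable (∁ᵇ Q) (trans (∂-∁ G Q) ∂Q≡4) (cong not Qa) (Crossᵇ-∁ Q×C)

  module _ {a b} (a≢b : a ≢ b) (ab : DoubleEdge G a b) (only-b : ∀ c → DoubleEdge G a c → c ≡ b) where

    Separating : (Fin m → Bool) → Set
    Separating T = T a ≡ true × T b ≡ false × ∂ G T ≡ 4 × ∃ λ x → T x ≡ true × x ≢ a

    -ᵇ-true : ∀ T {z} → (T -ᵇ a) z ≡ true → T z ≡ true × z ≢ a
    -ᵇ-true T {z} Cz = let Tz , a≉z = ∧≡true⇒ {T z} Cz in Tz , δ≡false⇒≢ (not-injective a≉z) ∘ sym

    -ᵇ-false : ∀ T {z} → (T -ᵇ a) z ≡ false → a ≢ z → T z ≡ false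
    -ᵇ-false T {z} Cz a≢z = trans (sym (∧-identityʳ (T z))) (trans (cong (λ d → T z ∧ not d) (sym (δ-≢ a≢z))) Cz)

    ∂-minus≤4 : ∀ {T} → Separating T → ∂ G (T -ᵇ a) ≤ 4
    ∂-minus≤4 {T} (Ta , Tb , ∂T≡4 , _) = +-cancelˡ-≤ 4 _ 4 (begin
      4 + ∂ G (T -ᵇ a)                                                ≡⟨ cong₂ _+_ ∂-meet (trans (∂-cong G join) (∂-∁ G (T -ᵇ a))) ⟨
      ∂ G ((⁅ a ⁆ ∪ᵇ ⁅ b ⁆) ∩ᵇ ∁ᵇ T) + ∂ G ((⁅ a ⁆ ∪ᵇ ⁅ b ⁆) ∪ᵇ ∁ᵇ T) ≤⟨ ∂-submodular G (⁅ a ⁆ ∪ᵇ ⁅ b ⁆) (∁ᵇ T) ⟩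
      ∂ G (⁅ a ⁆ ∪ᵇ ⁅ b ⁆) + ∂ G (∁ᵇ T)                              ≡⟨ cong₂ _+_ (double⇒∂-pair≡4 a≢b ab) (trans (∂-∁ G T) ∂T≡4) ⟩
      4 + 4                                                           ∎)
      where
      open ≤-Reasoning
      meet : ∀ z → (δ a z ∨ δ b z) ∧ not (T z) ≡ δ b z
      meet z with a ≟ z
      ... | yes refl rewrite Ta = sym (δ-≢ (a≢b ∘ sym))
      ... | no _ with b ≟ z
      ...   | yes refl rewrite Tb = refl
      ...   | no _ = refl
      ∂-meet : ∂ G ((⁅ a ⁆ ∪ᵇ ⁅ b ⁆) ∩ᵇ ∁ᵇ T) ≡ 4
      ∂-meet = trans (∂-cong G meet) (trans (∂-⁅⁆ G b) (regular b))
      join : ∀ z → (δ a z ∨ δ b z) ∨ not (T z) ≡ not (T z ∧ not (δ a z))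
      join z with a ≟ z
      ... | yes refl rewrite Ta = refl
      ... | no _ with b ≟ z
      ...   | yes refl rewrite Tb = refl
      ...   | no _ with T z
      ...     | true  = refl
      ...     | false = refl

    pair-not-separating : ∀ {T x} → Separating T → T x ≡ true → x ≢ a → (∀ z → (T -ᵇ a) z ≡ true → z ≡ x) → ⊥
    pair-not-separating {T} {x} (Ta , Tb , ∂T≡4 , _) Tx x≢a only-x =
      x≢b (only-b x (∂-pair≡4⇒double (x≢a ∘ sym) (trans (sym (∂-cong G T≗pair)) ∂T≡4)))
      where
      x≢b : x ≢ b
      x≢b refl = contradiction (trans (sym Tx) Tb) λ ()
      T≗pair : ∀ z → T z ≡ (δ a z ∨ δ x z)
      T≗pair z with a ≟ z
      ... | yes refl = Ta
      ... | no a≢z with x ≟ z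
      ...   | yes refl = Tx
      ...   | no x≢z with T z in Tz
      ...     | false = refl
      ...     | true  = contradiction (sym (only-x z (cong₂ _∧_ Tz (cong not (δ-≢ a≢z))))) x≢z

    shrink : ∀ {T Q} → Separating T → ∂ G Q ≡ 4 → Q a ≡ true → Crossᵇ Q (T -ᵇ a) →
             ∃ λ T′ → Separating T′ × count T′ < count T
    shrink {T} {Q} (Ta , Tb , ∂T≡4 , _) ∂Q≡4 Qa ((e₁ , Qe₁ , Ce₁) , _ , (e₃ , Qe₃ , Ce₃) , (e₄ , Qe₄ , Ce₄))
      with Fin.any? (λ f → (Q f Bool.≟ true) ×-dec (T f Bool.≟ false))
    ... | no Q⊈T = Q , (Qa , Qb , ∂Q≡4 , e₁ , Qe₁ , proj₂ (-ᵇ-true T Ce₁)) , count-mono-< Q⊆T e₃ Qe₃ (proj₁ (-ᵇ-true T Ce₃))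
      where
      Q⊆T : Q ⊆ᵇ T
      Q⊆T z Qz with T z in Tz
      ... | true  = refl
      ... | false = contradiction (z , Qz , Tz) Q⊈T
      Qb : Q b ≡ false
      Qb with Q b in Qb
      ... | false = refl
      ... | true  = contradiction (trans (sym (Q⊆T b Qb)) Tb) λ ()
    ... | yes (f , Qf , Tf) =
      (T ∩ᵇ Q) ,
      (cong₂ _∧_ Ta Qa , cong (_∧ Q b) Tb , ∂T∩Q≡4 , e₁ , cong₂ _∧_ (proj₁ (-ᵇ-true T Ce₁)) Qe₁ , proj₂ (-ᵇ-true T Ce₁)) ,
      count-mono-< (λ z → proj₁ ∘ ∧≡true⇒) e₃ (trans (cong (_∧ Q e₃) Te₃) Qe₃) Te₃
      where
      Te₃ : T e₃ ≡ true
      Te₃ = proj₁ (-ᵇ-true T Ce₃)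
      Te₄ : T e₄ ≡ false
      Te₄ = -ᵇ-false T Ce₄ λ { refl → contradiction (trans (sym Qa) Qe₄) λ () }
      4≤∂T∪Q : 4 ≤ ∂ G (T ∪ᵇ Q)
      4≤∂T∪Q = edgeConnected⇒≤∂ G connected (T ∪ᵇ Q) (cong (_∨ Q a) Ta) (cong₂ _∨_ Te₄ Qe₄)
      ∂T∩Q≡4 : ∂ G (T ∩ᵇ Q) ≡ 4
      ∂T∩Q≡4 = ≤-antisym
        (+-cancelʳ-≤ 4 _ 4 (begin
          ∂ G (T ∩ᵇ Q) + 4               ≤⟨ +-monoʳ-≤ _ 4≤∂T∪Q ⟩
          ∂ G (T ∩ᵇ Q) + ∂ G (T ∪ᵇ Q)    ≤⟨ ∂-submodular G T Q ⟩
          ∂ G T + ∂ G Q                  ≡⟨ cong₂ _+_ ∂T≡4 ∂Q≡4 ⟩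
          4 + 4                          ∎))
        (edgeConnected⇒≤∂ G connected (T ∩ᵇ Q) (cong₂ _∧_ Ta Qa) (cong (_∧ Q f) Tf))
        where open ≤-Reasoning

    -- T − a is a proper tight set, so terminality makes a tight set cross it, and uncrossing
    -- against T yields a strictly smaller separating set.
    no-separating : ∀ k T → count T ≤ k → Separating T → ⊥
    no-separating zero T T≤0 (Ta , _) = contradiction (≤-trans (count-pos T Ta) T≤0) λ ()
    no-separating (suc k) T T≤1+k sep@(Ta , Tb , _ , x , Tx , x≢a)
      with Fin.any? (λ z → ((T -ᵇ a) z Bool.≟ true) ×-dec ¬? (z ≟ x))
    ... | no no-other = pair-not-separating sep Tx x≢a only-x
      where
      only-x : ∀ z → (T -ᵇ a) z ≡ true → z ≡ x
      only-x z Cz with z ≟ x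
      ... | yes z≡x = z≡x
      ... | no z≢x  = contradiction (z , Cz , z≢x) no-other
    ... | yes (z , Cz , z≢x) = crossed-through C a C-tight λ Q ∂Q≡4 Qa Q×C →
      let T′ , sep′ , T′<T = shrink sep ∂Q≡4 Qa Q×C in no-separating k T′ (≤-pred (≤-trans T′<T T≤1+k)) sep′
      where
      C : Fin m → Bool
      C = T -ᵇ a
      Cx : C x ≡ true
      Cx = cong₂ _∧_ Tx (cong not (δ-≢ (x≢a ∘ sym)))
      Ca : C a ≡ false
      Ca = cong₂ _∧_ Ta (cong not (δ-refl a))
      Cb : C b ≡ false
      Cb = cong (_∧ not (δ a b)) Tb
      C-tight : ProperTight G (tabulate C)
      C-tight = properTight-tabulate G connected C Cx Cb (count-two C (z≢x ∘ sym) Cx Cz)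
                  (subst (count C + 2 ≤_) (count-∁ C) (+-monoʳ-≤ (count C) (count-two (∁ᵇ C) a≢b (cong not Ca) (cong not Cb))))
                  (∂-minus≤4 sep)

    pair-crossed : 4 ≤ m → ⊥
    pair-crossed 4≤m =
      let e , a≢e , b≢e = outside-pair (≤-trans (n≤1+n 3) 4≤m) a b
      in crossed-through X a (X-tight (cong₂ _∨_ (δ-≢ a≢e) (δ-≢ b≢e))) separating
      where
      X : Fin m → Bool
      X = ⁅ a ⁆ ∪ᵇ ⁅ b ⁆
      Xa : X a ≡ true
      Xa = cong (_∨ δ b a) (δ-refl a)
      Xb : X b ≡ true
      Xb = trans (cong (δ a b ∨_) (δ-refl b)) (∨-zeroʳ (δ a b))
      X-tight : ∀ {e} → X e ≡ false → ProperTight G (tabulate X)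
      X-tight Xe = properTight-tabulate G connected X Xa Xe (count-two X a≢b Xa Xb)
                     (≤-trans (+-monoˡ-≤ 2 (count-pair≤2 a b)) 4≤m) (≤-reflexive (double⇒∂-pair≡4 a≢b ab))
      separating : ∀ Q → ∂ G Q ≡ 4 → Q a ≡ true → Crossᵇ Q X → ⊥
      separating Q ∂Q≡4 Qa (_ , (e₂ , Qe₂ , Xe₂) , (e₃ , Qe₃ , Xe₃) , _) =
        no-separating (count Q) Q ≤-refl (Qa , Qb , ∂Q≡4 , e₂ , Qe₂ , δ≡false⇒≢ (proj₁ (∨≡false⇒ Xe₂)) ∘ sym)
        where
        Qb : Q b ≡ false
        Qb with a ≟ e₃
        ... | yes refl = contradiction (trans (sym Qa) Qe₃) λ ()
        ... | no _     = subst (λ v → Q v ≡ false) (sym (δ⇒≡ Xe₃)) Qe₃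

  doubleEdgesContinue : 4 ≤ m → DoubleEdgesContinue G
  doubleEdgesContinue 4≤m {a} {b} ab with Fin.any? (λ c → ¬? (c ≟ b) ×-dec (mult G a c ℕ.≟ 2))
  ... | yes found = found
  ... | no none   = ⊥-elim (pair-crossed a≢b ab only-b 4≤m)
    where
    a≢b : a ≢ b
    a≢b refl = double-edge-irrefl a ab
    only-b : ∀ c → DoubleEdge G a c → c ≡ b
    only-b c ac with c ≟ b
    ... | yes c≡b = c≡b
    ... | no c≢b  = contradiction (c , c≢b , ac) none

terminal⇒doubleEdgesContinue : ∀ {m} (G : MG m) → FourRegular G → EdgeConnected 4 G → Terminal G → 3 ≤ m →
                               DoubleEdgesContinue G
terminal⇒doubleEdgesContinue G regular connected terminal 3≤m with m≤n⇒m<n∨m≡n 3≤m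
... | inj₁ 4≤m  = TerminalGraph.doubleEdgesContinue G regular connected terminal 4≤m
... | inj₂ refl = continue
  where
  continue : DoubleEdgesContinue G
  continue {a} {b} _ = let c , a≢c , b≢c = outside-pair ≤-refl a b in c , b≢c ∘ sym , triangle-double-edges G regular a≢c

-- Following double edges

module DoubleCycleWalk {m} (G : MG m) (regular : FourRegular G) (connected : EdgeConnected 4 G)
                       (continue : DoubleEdgesContinue G) {r u} (ru : DoubleEdge G r u) where

  open FourRegularGraph G regular

  -- The default b is a junk value, never reached along a walk of double edges.
  next : Fin m → Fin m → Fin m
  next a b with Fin.any? (λ c → ¬? (c ≟ b) ×-dec (mult G a c ℕ.≟ 2))
  ... | yes (c , _) = c
  ... | no _        = b

  next-continues : ∀ {a b} → DoubleEdge G a b → next a b ≢ b × DoubleEdge G a (next a b)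
  next-continues {a} {b} ab with Fin.any? (λ c → ¬? (c ≟ b) ×-dec (mult G a c ℕ.≟ 2))
  ... | yes (c , c≢b , ac) = c≢b , ac
  ... | no none             = contradiction (continue ab) none

  walk : ℕ → Fin m
  walk zero          = r
  walk (suc zero)    = u
  walk (suc (suc i)) = next (walk (suc i)) (walk i)

  walk-double : ∀ i → DoubleEdge G (walk i) (walk (suc i))
  walk-double zero    = ru
  walk-double (suc i) = proj₂ (next-continues (DoubleEdge-sym G (walk-double i)))

  walk-turn : ∀ i → walk (suc (suc i)) ≢ walk i
  walk-turn i = proj₁ (next-continues (DoubleEdge-sym G (walk-double i)))

  walk-step-≢ : ∀ i → walk (suc i) ≢ walk i
  walk-step-≢ i e = double-edge-irrefl (walk i) (subst (DoubleEdge G (walk i)) e (walk-double i))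

  beside-walk : ∀ i {v} → v ≢ walk i → v ≢ walk (suc (suc i)) → mult G (walk (suc i)) v ≡ 0
  beside-walk i = beside-two-double-edges (walk-turn i ∘ sym) (DoubleEdge-sym G (walk-double i)) (walk-double (suc i))

  InjectiveBelow : ℕ → Set
  InjectiveBelow k = ∀ {i j} → i < k → j < k → walk i ≡ walk j → i ≡ j

  extend : ∀ {k} → InjectiveBelow k → (∀ {j} → j < k → walk k ≢ walk j) → InjectiveBelow (suc k)
  extend inj fresh i<1+k j<1+k eq with m≤n⇒m<n∨m≡n (≤-pred i<1+k) | m≤n⇒m<n∨m≡n (≤-pred j<1+k)
  ... | inj₁ i<k  | inj₁ j<k  = inj i<k j<k eq
  ... | inj₁ i<k  | inj₂ refl = contradiction (sym eq) (fresh i<k)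
  ... | inj₂ refl | inj₁ j<k  = contradiction eq (fresh j<k)
  ... | inj₂ refl | inj₂ refl = refl

  -- A vertex walk j with 0 < j already has both of its double neighbours on the walk.
  returns-to-start : ∀ {k j} → InjectiveBelow k → j < k → walk k ≡ walk j → j ≡ 0
  returns-to-start {suc k} {zero}  inj _ _ = refl
  returns-to-start {suc k} {suc j} inj (s≤s 1+j≤k) eq with m≤n⇒m<n∨m≡n 1+j≤k
  ... | inj₂ refl = contradiction eq (walk-step-≢ (suc j))
  ... | inj₁ 2+j≤k with m≤n⇒m<n∨m≡n 2+j≤k
  ...   | inj₂ refl = contradiction eq (walk-turn (suc j))
  ...   | inj₁ 3+j≤k = contradiction (trans (sym (beside-walk j k≢j k≢2+j)) double) λ ()
    where
    double : DoubleEdge G (walk (suc j)) (walk k)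
    double = subst (λ w → DoubleEdge G w (walk k)) eq (DoubleEdge-sym G (walk-double k))
    k<1+k : k < suc k
    k<1+k = n<1+n k
    k≢j : walk k ≢ walk j
    k≢j e = <⇒≢ (<-trans (n<1+n j) 2+j≤k) (sym (inj k<1+k (<-trans (<-trans (n<1+n j) 2+j≤k) k<1+k) e))
    k≢2+j : walk k ≢ walk (suc (suc j))
    k≢2+j e = <⇒≢ 3+j≤k (sym (inj k<1+k (<-trans 3+j≤k k<1+k) e))

  closed-start : ∀ {k} → InjectiveBelow k → walk k ≡ walk 0 → 0 < k →
                 walk 1 ≢ walk (ℕ.pred k) × DoubleEdge G (walk 0) (walk (ℕ.pred k))
  closed-start {suc zero}          _   closed _ = contradiction closed (walk-step-≢ 0)
  closed-start {suc (suc zero)}    _   closed _ = contradiction closed (walk-turn 0)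
  closed-start {suc (suc (suc k))} inj closed _ =
    (λ e → contradiction (inj (s≤s (s≤s z≤n)) (n<1+n (suc (suc k))) e) λ ()) ,
    subst (λ w → DoubleEdge G w (walk (suc (suc k)))) closed (DoubleEdge-sym G (walk-double (suc (suc k))))

  cyc-pred : ℕ → ℕ → ℕ
  cyc-pred k zero    = ℕ.pred k
  cyc-pred k (suc i) = i

  module ClosedWalk {k} (inj : InjectiveBelow k) (closed : walk k ≡ walk 0) (0<k : 0 < k) where

    cyc-pred<k : ∀ {i} → i < k → cyc-pred k i < k
    cyc-pred<k {zero}  _   = ≤-reflexive (suc-pred k {{ℕ.>-nonZero 0<k}})
    cyc-pred<k {suc i} i<k = <-trans (n<1+n i) i<k

    off-cycle-zero : ∀ {i v} → i < k → v ≢ walk (cyc-pred k i) → v ≢ walk (suc i) → mult G (walk i) v ≡ 0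
    off-cycle-zero {suc i} _ v≢prev v≢next = beside-walk i v≢prev v≢next
    off-cycle-zero {zero}  _ v≢prev v≢next =
      let 1≢prev , double-prev = closed-start inj closed 0<k
      in beside-two-double-edges 1≢prev (walk-double 0) double-prev v≢next v≢prev

    onWalk : Fin m → Bool
    onWalk v = does (Fin.any? λ (i : Fin k) → walk (toℕ i) ≟ v)

    walk-onWalk : ∀ {i} → i < k → onWalk (walk i) ≡ true
    walk-onWalk i<k = dec-true (Fin.any? _) (fromℕ< i<k , cong walk (Fin.toℕ-fromℕ< i<k))

    onWalk⇒index : ∀ {v} → onWalk v ≡ true → ∃ λ (i : Fin k) → walk (toℕ i) ≡ v
    onWalk⇒index {v} on with Fin.any? (λ (i : Fin k) → walk (toℕ i) ≟ v)
    ... | yes found = found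

    successor-onWalk : ∀ {i} → i < k → onWalk (walk (suc i)) ≡ true
    successor-onWalk {i} i<k with m≤n⇒m<n∨m≡n i<k
    ... | inj₁ 1+i<k = walk-onWalk 1+i<k
    ... | inj₂ refl  = subst (λ w → onWalk w ≡ true) (sym closed) (walk-onWalk 0<k)

    ∂-onWalk≡0 : ∂ G onWalk ≡ 0
    ∂-onWalk≡0 = trans (∑∑-cong no-edge-leaves) (trans (∑-cong {m} (λ _ → ∑-zero m)) (∑-zero m))
      where
      no-edge-leaves : ∀ x v → (if onWalk x ∧ not (onWalk v) then mult G x v else 0) ≡ 0
      no-edge-leaves x v with onWalk x in on-x | onWalk v in on-v
      ... | false | _     = refl
      ... | true  | true  = refl
      ... | true  | false with onWalk⇒index on-x
      ...   | i , refl =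
        off-cycle-zero (Fin.toℕ<n i) (off (walk-onWalk (cyc-pred<k (Fin.toℕ<n i)))) (off (successor-onWalk (Fin.toℕ<n i)))
        where
        off : ∀ {w} → onWalk w ≡ true → v ≢ w
        off on-w refl = contradiction (trans (sym on-w) on-v) λ ()

    spans : m ≤ k
    spans with Fin.any? (λ v → onWalk v Bool.≟ false)
    ... | yes (v , off-v) =
      contradiction (≤-trans (edgeConnected⇒≤∂ G connected onWalk (walk-onWalk 0<k) off-v) (≤-reflexive ∂-onWalk≡0)) λ ()
    ... | no all-on = Fin.injective⇒≤ {f = index} index-injective
      where
      on : ∀ v → onWalk v ≡ true
      on v with onWalk v in on-v
      ... | true  = refl
      ... | false = contradiction (v , on-v) all-on
      index : Fin m → Fin k
      index v = proj₁ (onWalk⇒index (on v))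
      index-injective : ∀ {v w} → index v ≡ index w → v ≡ w
      index-injective {v} {w} eq =
        trans (sym (proj₂ (onWalk⇒index (on v)))) (trans (cong (walk ∘ toℕ) eq) (proj₂ (onWalk⇒index (on w))))

  walk-injective : ∀ k → k ≤ m → InjectiveBelow k
  walk-injective zero    _     ()
  walk-injective (suc k) 1+k≤m with Fin.any? (λ (j : Fin k) → walk k ≟ walk (toℕ j))
  ... | no fresh = extend inj λ j<k e → fresh (fromℕ< j<k , trans e (cong walk (sym (Fin.toℕ-fromℕ< j<k))))
    where
    inj : InjectiveBelow k
    inj = walk-injective k (≤-trans (n≤1+n k) 1+k≤m)
  ... | yes (j , e) = contradiction 1+k≤m (<⇒≱ (s≤s (ClosedWalk.spans inj closed 0<k)))
    where
    inj : InjectiveBelow k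
    inj = walk-injective k (≤-trans (n≤1+n k) 1+k≤m)
    closed : walk k ≡ walk 0
    closed = trans e (cong walk (returns-to-start inj (Fin.toℕ<n j) e))
    0<k : 0 < k
    0<k = ≤-trans (s≤s z≤n) (Fin.toℕ<n j)

  walk-closes : walk m ≡ walk 0
  walk-closes with Fin.any? (λ (j : Fin m) → walk m ≟ walk (toℕ j))
  ... | yes (j , e) = trans e (cong walk (returns-to-start (walk-injective m ≤-refl) (Fin.toℕ<n j) e))
  ... | no fresh =
    contradiction (Fin.injective⇒≤ {f = walk ∘ toℕ} λ e → Fin.toℕ-injective (inj (Fin.toℕ<n _) (Fin.toℕ<n _) e)) 1+n≰n
    where
    inj : InjectiveBelow (suc m)
    inj = extend (walk-injective m ≤-refl) λ j<m e → fresh (fromℕ< j<m , trans e (cong walk (sym (Fin.toℕ-fromℕ< j<m))))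

  doubleCycle : 3 ≤ m → DoubleCycle G
  doubleCycle 3≤m = inj₂ (3≤m , σ , σ-injective , λ i j → adjacent i j , non-adjacent i j)
    where
    0<m : 0 < m
    0<m = ≤-trans (s≤s z≤n) 3≤m
    inj : InjectiveBelow m
    inj = walk-injective m ≤-refl
    open ClosedWalk inj walk-closes 0<m
    σ : Fin m → Fin m
    σ = walk ∘ toℕ
    σ-injective : Injective _≡_ _≡_ σ
    σ-injective e = Fin.toℕ-injective (inj (Fin.toℕ<n _) (Fin.toℕ<n _) e)
    succ-double : ∀ i j → CycSucc i j → DoubleEdge G (σ i) (σ j)
    succ-double i j (inj₁ j≡1+i)         = subst (DoubleEdge G (σ i) ∘ walk) (sym j≡1+i) (walk-double (toℕ i))
    succ-double i j (inj₂ (1+i≡m , j≡0)) =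
      subst (DoubleEdge G (σ i)) (trans (cong walk 1+i≡m) (trans walk-closes (cong walk (sym j≡0)))) (walk-double (toℕ i))
    adjacent : ∀ i j → CycAdj i j → DoubleEdge G (σ i) (σ j)
    adjacent i j (inj₁ i→j) = succ-double i j i→j
    adjacent i j (inj₂ j→i) = DoubleEdge-sym G (succ-double j i j→i)
    cyc-pred⇒CycSucc : ∀ i j → toℕ j ≡ cyc-pred m (toℕ i) → CycSucc j i
    cyc-pred⇒CycSucc i j j≡prev with toℕ i
    ... | zero  = inj₂ (trans (cong suc j≡prev) (suc-pred m {{ℕ.>-nonZero 0<m}}) , refl)
    ... | suc _ = inj₁ (cong suc (sym j≡prev))
    next⇒CycSucc : ∀ i j → σ j ≡ walk (suc (toℕ i)) → CycSucc i j
    next⇒CycSucc i j e with m≤n⇒m<n∨m≡n (Fin.toℕ<n i)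
    ... | inj₁ 1+i<m = inj₁ (inj (Fin.toℕ<n j) 1+i<m e)
    ... | inj₂ 1+i≡m = inj₂ (1+i≡m , inj (Fin.toℕ<n j) 0<m (trans e (trans (cong walk 1+i≡m) walk-closes)))
    non-adjacent : ∀ i j → ¬ CycAdj i j → mult G (σ i) (σ j) ≡ 0
    non-adjacent i j ¬adj = off-cycle-zero (Fin.toℕ<n i)
      (λ e → ¬adj (inj₂ (cyc-pred⇒CycSucc i j (inj (Fin.toℕ<n j) (cyc-pred<k (Fin.toℕ<n i)) e))))
      (λ e → ¬adj (inj₁ (next⇒CycSucc i j e)))

claim4p1 : ∀ {n} (G₀ : MG n) (r₀ u₀ v₀ : Fin n) →
    FourRegular G₀ → EdgeConnected 4 G₀ →
    r₀ ≢ u₀ → r₀ ≢ v₀ → u₀ ≢ v₀ →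
    mult G₀ r₀ u₀ ≡ 2 → mult G₀ r₀ v₀ ≡ 2 →
    ∀ {m} (G : MG m) (r : Fin m) →
    Star Step (n , G₀ , r₀) (m , G , r) → Terminal G → DoubleCycle G
claim4p1 G₀ r₀ u₀ v₀ regular₀ connected₀ r₀≢u₀ r₀≢v₀ u₀≢v₀ r₀u₀ _ {m} G r steps terminal =
  DoubleCycleWalk.doubleCycle G regular connected (terminal⇒doubleEdgesContinue G regular connected terminal 3≤m) double 3≤m
  where
  initial : Invariant G₀ r₀
  initial = record
    { regular = regular₀ ; connected = connected₀ ; partner = u₀ ; r≢partner = r₀≢u₀ ; double = r₀u₀
    ; third = v₀ ; third≢r = r₀≢v₀ ∘ sym ; third≢partner = u₀≢v₀ ∘ sym }
  open Invariant (Star-preserves-invariant steps initial)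
  3≤m : 3 ≤ m
  3≤m = three-distinct⇒3≤n r≢partner (third≢r ∘ sym) (third≢partner ∘ sym)
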